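{- Let $A$ and $B$ be diversified formulae of $\mathcal{L}_{\neg,\wedge,\vee}$. Then $A\leftrightarrow B$ is a tautology if and only if $A\leftrightarrow B$ is a theorem of the system $\mathcal{S}_{\neg,\wedge,\vee}$.
   Context: $\mathcal{L}_{\neg,\wedge,\vee}$ is the propositional language generated from an infinite set of propositional letters by the unary connective $\neg$ and the binary connectives $\wedge,\vee$. A formula is diversified when every letter occurs in it at most once. Tautology means classical tautology, with $\leftrightarrow$ material equivalence. The formal system $\mathcal{S}_{\neg,\wedge,\vee}$ derives expressions $A\leftrightarrow B$ with $A,B$ in $\mathcal{L}_{\neg,\wedge,\vee}$; its axioms are all instances (with formulae of $\mathcal{L}_{\neg,\wedge,\vee}$) of $A\leftrightarrow A$, $((A\wedge B)\wedge C)\leftrightarrow(A\wedge(B\wedge C))$, $((A\vee B)\vee C)\leftrightarrow(A\vee(B\vee C))$, $(A\wedge B)\leftrightarrow(B\wedge A)$, $(A\vee B)\leftrightarrow(B\vee A)$, $\neg\neg A\leftrightarrow A$, $\neg(A\wedge B)\leftrightarrow(\neg A\vee\neg B)$, $\neg(A\vee B)\leftrightarrow(\neg A\wedge\neg B)$, and its rules are: from $A\leftrightarrow B$ infer $B\leftrightarrow A$; from $A\leftrightarrow B$ and $B\leftrightarrow C$ infer $A\leftrightarrow C$; from $A\leftrightarrow B$ and $C\leftrightarrow D$ infer $(A\wedge C)\leftrightarrow(B\wedge D)$ and $(A\vee C)\leftrightarrow(B\vee D)$; from $A\leftrightarrow B$ infer $\neg A\leftrightarrow\neg B$. -}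

module Defs where

open import Data.Nat using (ℕ)
open import Data.Bool using (Bool; not; _∧_; _∨_)
open import Data.List using (List; []; [_]; _++_)
open import Data.List.Relation.Unary.Unique.Propositional using (Unique)
open import Relation.Binary.PropositionalEquality using (_≡_)

data Formula : Set where
  var  : ℕ → Formula
  ¬'_  : Formula → Formula
  _∧'_ : Formula → Formula → Formula
  _∨'_ : Formula → Formula → Formula

infix  6 ¬'_
infixr 5 _∧'_
infixr 4 _∨'_

letters : Formula → List ℕ
letters (var p)  = [ p ]
letters (¬' A)   = letters A
letters (A ∧' B) = letters A ++ letters B
letters (A ∨' B) = letters A ++ letters B

Diversified : Formula → Set
Diversified A = Unique (letters A)

eval : (ℕ → Bool) → Formula → Bool
eval v (var p)  = v p
eval v (¬' A)   = not (eval v A)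
eval v (A ∧' B) = eval v A ∧ eval v B
eval v (A ∨' B) = eval v A ∨ eval v B

TautEquiv : Formula → Formula → Set
TautEquiv A B = ∀ (v : ℕ → Bool) → eval v A ≡ eval v B

infix 2 _⊢↔_
data _⊢↔_ : Formula → Formula → Set where
  ax-refl   : ∀ {A} → A ⊢↔ A
  ax-∧assoc : ∀ {A B C} → (A ∧' B) ∧' C ⊢↔ A ∧' (B ∧' C)
  ax-∨assoc : ∀ {A B C} → (A ∨' B) ∨' C ⊢↔ A ∨' (B ∨' C)
  ax-∧comm  : ∀ {A B} → A ∧' B ⊢↔ B ∧' A
  ax-∨comm  : ∀ {A B} → A ∨' B ⊢↔ B ∨' A
  ax-¬¬     : ∀ {A} → ¬' ¬' A ⊢↔ A
  ax-¬∧     : ∀ {A B} → ¬' (A ∧' B) ⊢↔ (¬' A) ∨' (¬' B)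
  ax-¬∨     : ∀ {A B} → ¬' (A ∨' B) ⊢↔ (¬' A) ∧' (¬' B)
  r-sym     : ∀ {A B} → A ⊢↔ B → B ⊢↔ A
  r-trans   : ∀ {A B C} → A ⊢↔ B → B ⊢↔ C → A ⊢↔ C
  r-∧       : ∀ {A B C D} → A ⊢↔ B → C ⊢↔ D → A ∧' C ⊢↔ B ∧' D
  r-∨       : ∀ {A B C D} → A ⊢↔ B → C ⊢↔ D → A ∨' C ⊢↔ B ∨' D
  r-¬       : ∀ {A B} → A ⊢↔ B → ¬' A ⊢↔ ¬' B

-- Both sides are brought to negation normal form, which is read-once as the formulae are
-- diversified; so it suffices that semantically equivalent read-once formulae A, B are provably
-- equivalent. Every letter of a read-once formula is essential, hence A and B have the same
-- letters. Fixing all letters but p and q turns a read-once formula into a function of (p, q)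
-- whose o-preimage is a product set, o being the label of the node where p and q meet; for a
-- suitable choice of the fixed letters it is op o of two literals, whose (not o)-preimage has
-- three points. So if A = A₁ · A₂ ≡ B, a letter of A₁ and one of A₂ meet in B only at ·-nodes,
-- and associativity and commutativity rearrange B into B₁ · B₂ with the letters of A₁ in B₁
-- and those of A₂ in B₂. Fixing the letters of A₂ so that A₂ takes the unit of · gives
-- A₁ ≡ B₁, likewise A₂ ≡ B₂, and induction on A concludes.

module Submission where

open import Defs
open import Data.Nat using (ℕ; _≟_)
open import Level using (0ℓ)
open import Algebra.Bundles using (CommutativeSemigroup)
import Algebra.Properties.CommutativeSemigroup as CommutativeSemigroupProperties
open import Data.Bool using (Bool; true; false; not; _∧_; _∨_; if_then_else_)
open import Data.Bool.Properties
  using (∧-assoc; ∨-assoc; ∧-comm; ∨-comm; ∧-identityʳ; ∨-identityʳ; ∧-zeroʳ; ∨-zeroʳ;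
         not-involutive; not-injective; not-¬; ¬-not; ∨-∧-booleanAlgebra)
  renaming (_≟_ to _≟ᵇ_)
open import Algebra.Lattice.Properties.BooleanAlgebra ∨-∧-booleanAlgebra using (deMorgan₁; deMorgan₂)
open import Data.Empty using (⊥-elim)
open import Data.List using (List; []; _∷_; [_]; _++_)
open import Data.List.Properties using (++-identityʳ)
open import Data.List.Membership.Propositional using (_∈_; _∉_)
open import Data.List.Membership.Propositional.Properties using (∈-++⁺ˡ; ∈-++⁺ʳ; ∈-++⁻)
open import Data.List.Membership.DecPropositional _≟_ using (_∈?_)
open import Data.List.Relation.Binary.Disjoint.Propositional using (Disjoint)
open import Data.List.Relation.Binary.Subset.Propositional using (_⊆_)
import Data.List.Relation.Unary.All as All
import Data.List.Relation.Unary.All.Properties as All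
open import Data.List.Relation.Unary.AllPairs using ([]; _∷_)
open import Data.List.Relation.Unary.Any using (here; there)
open import Data.List.Relation.Unary.Unique.Propositional using (Unique)
open import Data.Maybe using (Maybe; just; nothing; maybe)
open import Data.Maybe.Relation.Binary.Pointwise as Pointwise using (Pointwise; just; nothing)
open import Data.Maybe.Relation.Unary.All as MaybeAll using (just; nothing)
open import Data.Product using (_×_; _,_; proj₁; proj₂; ∃; ∃₂; map₁; map₂)
open import Data.Sum using (_⊎_; inj₁; inj₂; [_,_]′)
open import Function using (_∘_)
open import Relation.Binary.Structures using (IsEquivalence)
open import Relation.Binary.PropositionalEquality
  using (_≡_; _≢_; _≗_; refl; sym; trans; cong; cong₂; subst; module ≡-Reasoning)
open import Relation.Nullary using (¬_; yes; no; does)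
open import Relation.Nullary.Decidable using (dec-true; dec-false; decidable-stable)

open ≡-Reasoning

sound : ∀ {A B} → A ⊢↔ B → TautEquiv A B
sound ax-refl _ = refl
sound (ax-∧assoc {A} {B} {C}) v = ∧-assoc (eval v A) (eval v B) (eval v C)
sound (ax-∨assoc {A} {B} {C}) v = ∨-assoc (eval v A) (eval v B) (eval v C)
sound (ax-∧comm {A} {B}) v = ∧-comm (eval v A) (eval v B)
sound (ax-∨comm {A} {B}) v = ∨-comm (eval v A) (eval v B)
sound (ax-¬¬ {A}) v = not-involutive (eval v A)
sound (ax-¬∧ {A} {B}) v = deMorgan₁ (eval v A) (eval v B)
sound (ax-¬∨ {A} {B}) v = deMorgan₂ (eval v A) (eval v B)
sound (r-sym d) v = sym (sound d v)
sound (r-trans d e) v = trans (sound d v) (sound e v)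
sound (r-∧ d e) v = cong₂ _∧_ (sound d v) (sound e v)
sound (r-∨ d e) v = cong₂ _∨_ (sound d v) (sound e v)
sound (r-¬ d) v = cong not (sound d v)

-- node true is ∧ and node false is ∨, so that o is the unit of op o and not o its zero.
data NNF : Set where
  lit  : Bool → ℕ → NNF
  node : Bool → NNF → NNF → NNF

op : Bool → Bool → Bool → Bool
op true  = _∧_
op false = _∨_

signed : Bool → Bool → Bool
signed true  x = x
signed false x = not x

Valuation : Set
Valuation = ℕ → Bool

⟦_⟧ : NNF → Valuation → Bool
⟦ lit b p ⟧    v = signed b (v p)
⟦ node o A B ⟧ v = op o (⟦ A ⟧ v) (⟦ B ⟧ v)

vars : NNF → List ℕ
vars (lit _ p)    = [ p ]
vars (node _ A B) = vars A ++ vars B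

toFormula : NNF → Formula
toFormula (lit true p)     = var p
toFormula (lit false p)    = ¬' var p
toFormula (node true A B)  = toFormula A ∧' toFormula B
toFormula (node false A B) = toFormula A ∨' toFormula B

eval-toFormula : ∀ v A → eval v (toFormula A) ≡ ⟦ A ⟧ v
eval-toFormula v (lit true p)     = refl
eval-toFormula v (lit false p)    = refl
eval-toFormula v (node true A B)  = cong₂ _∧_ (eval-toFormula v A) (eval-toFormula v B)
eval-toFormula v (node false A B) = cong₂ _∨_ (eval-toFormula v A) (eval-toFormula v B)

nnf nnf¬ : Formula → NNF
nnf (var p)   = lit true p
nnf (¬' A)    = nnf¬ A
nnf (A ∧' B)  = node true (nnf A) (nnf B)
nnf (A ∨' B)  = node false (nnf A) (nnf B)
nnf¬ (var p)  = lit false p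
nnf¬ (¬' A)   = nnf A
nnf¬ (A ∧' B) = node false (nnf¬ A) (nnf¬ B)
nnf¬ (A ∨' B) = node true (nnf¬ A) (nnf¬ B)

vars-nnf : ∀ A → vars (nnf A) ≡ letters A
vars-nnf¬ : ∀ A → vars (nnf¬ A) ≡ letters A
vars-nnf (var p)    = refl
vars-nnf (¬' A)     = vars-nnf¬ A
vars-nnf (A ∧' B)   = cong₂ _++_ (vars-nnf A) (vars-nnf B)
vars-nnf (A ∨' B)   = cong₂ _++_ (vars-nnf A) (vars-nnf B)
vars-nnf¬ (var p)   = refl
vars-nnf¬ (¬' A)    = vars-nnf A
vars-nnf¬ (A ∧' B)  = cong₂ _++_ (vars-nnf¬ A) (vars-nnf¬ B)
vars-nnf¬ (A ∨' B)  = cong₂ _++_ (vars-nnf¬ A) (vars-nnf¬ B)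

nnf-⊢↔ : ∀ A → A ⊢↔ toFormula (nnf A)
nnf¬-⊢↔ : ∀ A → ¬' A ⊢↔ toFormula (nnf¬ A)
nnf-⊢↔ (var p)   = ax-refl
nnf-⊢↔ (¬' A)    = nnf¬-⊢↔ A
nnf-⊢↔ (A ∧' B)  = r-∧ (nnf-⊢↔ A) (nnf-⊢↔ B)
nnf-⊢↔ (A ∨' B)  = r-∨ (nnf-⊢↔ A) (nnf-⊢↔ B)
nnf¬-⊢↔ (var p)  = ax-refl
nnf¬-⊢↔ (¬' A)   = r-trans ax-¬¬ (nnf-⊢↔ A)
nnf¬-⊢↔ (A ∧' B) = r-trans ax-¬∧ (r-∨ (nnf¬-⊢↔ A) (nnf¬-⊢↔ B))
nnf¬-⊢↔ (A ∨' B) = r-trans ax-¬∨ (r-∧ (nnf¬-⊢↔ A) (nnf¬-⊢↔ B))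

⟦nnf⟧ : ∀ v A → ⟦ nnf A ⟧ v ≡ eval v A
⟦nnf⟧ v A = sym (trans (sound (nnf-⊢↔ A) v) (eval-toFormula v (nnf A)))

infix 4 _≈_ _≋_

_≈_ : NNF → NNF → Set
A ≈ B = toFormula A ⊢↔ toFormula B

_≋_ : NNF → NNF → Set
A ≋ B = ∀ v → ⟦ A ⟧ v ≡ ⟦ B ⟧ v

≈⇒≋ : ∀ {A B} → A ≈ B → A ≋ B
≈⇒≋ {A} {B} A≈B v = trans (sym (eval-toFormula v A)) (trans (sound A≈B v) (eval-toFormula v B))

node-cong : ∀ o {A A′ B B′} → A ≈ A′ → B ≈ B′ → node o A B ≈ node o A′ B′
node-cong true  = r-∧
node-cong false = r-∨

node-assoc : ∀ o A B C → node o (node o A B) C ≈ node o A (node o B C)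
node-assoc true  _ _ _ = ax-∧assoc
node-assoc false _ _ _ = ax-∨assoc

node-comm : ∀ o A B → node o A B ≈ node o B A
node-comm true  _ _ = ax-∧comm
node-comm false _ _ = ax-∨comm

data ReadOnce : NNF → Set where
  lit  : ∀ {b p} → ReadOnce (lit b p)
  node : ∀ {o A B} → ReadOnce A → ReadOnce B → Disjoint (vars A) (vars B) → ReadOnce (node o A B)

unique-++⁻ : ∀ (xs : List ℕ) {ys} → Unique (xs ++ ys) → Unique xs × Unique ys × Disjoint xs ys
unique-++⁻ []       u = [] , u , λ ()
unique-++⁻ (x ∷ xs) (x∉ ∷ u) with unique-++⁻ xs u
... | u₁ , u₂ , xs#ys = All.++⁻ˡ xs x∉ ∷ u₁ , u₂ , λ where
  (here refl , x∈ys) → All.lookup (All.++⁻ʳ xs x∉) x∈ys refl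
  (there v∈xs , v∈ys) → xs#ys (v∈xs , v∈ys)

readOnce-unique : ∀ A → Unique (vars A) → ReadOnce A
readOnce-unique (lit _ _)    _ = lit
readOnce-unique (node _ A B) u with unique-++⁻ (vars A) u
... | uA , uB , A#B = node (readOnce-unique A uA) (readOnce-unique B uB) A#B

readOnce-nnf : ∀ A → Diversified A → ReadOnce (nnf A)
readOnce-nnf A div = readOnce-unique (nnf A) (subst Unique (sym (vars-nnf A)) div)

op-identityˡ : ∀ o x → op o o x ≡ x
op-identityˡ true  _ = refl
op-identityˡ false _ = refl

op-identityʳ : ∀ o x → op o x o ≡ x
op-identityʳ true  = ∧-identityʳ
op-identityʳ false = ∨-identityʳ

op-zeroˡ : ∀ o x → op o (not o) x ≡ not o
op-zeroˡ true  _ = refl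
op-zeroˡ false _ = refl

op-zeroʳ : ∀ o x → op o x (not o) ≡ not o
op-zeroʳ true  = ∧-zeroʳ
op-zeroʳ false = ∨-zeroʳ

op-comm : ∀ o x y → op o x y ≡ op o y x
op-comm true  = ∧-comm
op-comm false = ∨-comm

op-identity-inv : ∀ o x y → op o x y ≡ o → x ≡ o × y ≡ o
op-identity-inv true  true  _ e = refl , e
op-identity-inv false false _ e = refl , e

op-by-constant : ∀ o k → (∀ x → op o x k ≡ x) ⊎ (∀ x → op o x k ≡ not o)
op-by-constant true  true  = inj₁ ∧-identityʳ
op-by-constant true  false = inj₂ ∧-zeroʳ
op-by-constant false false = inj₁ ∨-identityʳ
op-by-constant false true  = inj₂ ∨-zeroʳ

signed-involutive : ∀ b x → signed b (signed b x) ≡ x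
signed-involutive true  _ = refl
signed-involutive false x = not-involutive x

signed-true : ∀ b → signed b true ≡ b
signed-true true  = refl
signed-true false = refl

signed-distinct : ∀ b → signed b true ≢ signed b false
signed-distinct true  ()
signed-distinct false ()

_[_≔_] : Valuation → ℕ → Bool → Valuation
(v [ p ≔ α ]) r = if does (r ≟ p) then α else v r

≔-same : ∀ v p α → (v [ p ≔ α ]) p ≡ α
≔-same v p α rewrite dec-true (p ≟ p) refl = refl

≔-other : ∀ v {p r} α → r ≢ p → (v [ p ≔ α ]) r ≡ v r
≔-other v {p} {r} α r≢p rewrite dec-false (r ≟ p) r≢p = refl

≔-≔-other : ∀ v {p q r} α β → r ≢ p → (v [ p ≔ α ] [ q ≔ β ]) r ≡ (v [ q ≔ β ]) r
≔-≔-other v {q = q} {r} α β r≢p = cong (if does (r ≟ q) then β else_) (≔-other v α r≢p)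

≔-cong : ∀ {v w} q β → v ≗ w → v [ q ≔ β ] ≗ w [ q ≔ β ]
≔-cong q β v≗w r = cong (if does (r ≟ q) then β else_) (v≗w r)

merge : (ℕ → Bool) → Valuation → Valuation → Valuation
merge X v u r = if X r then v r else u r

merge-≔ : ∀ X v u p α → merge X v u [ p ≔ α ] ≗ merge X (v [ p ≔ α ]) (u [ p ≔ α ])
merge-≔ X v u p α r with X r
... | true  = refl
... | false = refl

Coloured : (ℕ → Bool) → Bool → List ℕ → Set
Coloured X c xs = ∀ {r} → r ∈ xs → X r ≡ c

member : List ℕ → ℕ → Bool
member xs r = does (r ∈? xs)

member-colouring : ∀ {xs ys} → Disjoint xs ys →
  Coloured (member xs) true xs × Coloured (member xs) false ys
member-colouring {xs} xs#ys =
  (λ r∈xs → dec-true (_ ∈? xs) r∈xs) , (λ r∈ys → dec-false (_ ∈? xs) λ r∈xs → xs#ys (r∈xs , r∈ys))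

⟦⟧-local : ∀ A {v w} → (∀ {r} → r ∈ vars A → v r ≡ w r) → ⟦ A ⟧ v ≡ ⟦ A ⟧ w
⟦⟧-local (lit b p)    v≡w = cong (signed b) (v≡w (here refl))
⟦⟧-local (node o A B) v≡w =
  cong₂ (op o) (⟦⟧-local A (v≡w ∘ ∈-++⁺ˡ)) (⟦⟧-local B (v≡w ∘ ∈-++⁺ʳ (vars A)))

⟦⟧-≗ : ∀ A {v w} → v ≗ w → ⟦ A ⟧ v ≡ ⟦ A ⟧ w
⟦⟧-≗ A v≗w = ⟦⟧-local A (λ {r} _ → v≗w r)

⟦⟧-≔-∉ : ∀ A {v p} α → p ∉ vars A → ⟦ A ⟧ (v [ p ≔ α ]) ≡ ⟦ A ⟧ v
⟦⟧-≔-∉ A {v} α p∉ = ⟦⟧-local A (λ {r} r∈ → ≔-other v {r = r} α λ { refl → p∉ r∈ })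

⟦⟧-merge-true : ∀ A {X v u} → Coloured X true (vars A) → ⟦ A ⟧ (merge X v u) ≡ ⟦ A ⟧ v
⟦⟧-merge-true A {X} {v} {u} in-X = ⟦⟧-local A (λ {r} r∈ → cong (if_then v r else u r) (in-X r∈))

⟦⟧-merge-false : ∀ A {X v u} → Coloured X false (vars A) → ⟦ A ⟧ (merge X v u) ≡ ⟦ A ⟧ u
⟦⟧-merge-false A {X} {v} {u} out-X = ⟦⟧-local A (λ {r} r∈ → cong (if_then v r else u r) (out-X r∈))

⟦⟧-merge-node : ∀ {o A₁ A₂} → ReadOnce (node o A₁ A₂) → ∀ {w} v u →
  w ≗ merge (member (vars A₁)) v u → ⟦ node o A₁ A₂ ⟧ w ≡ op o (⟦ A₁ ⟧ v) (⟦ A₂ ⟧ u)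
⟦⟧-merge-node {o} {A₁} {A₂} (node _ _ A₁#A₂) v u w≗ =
  trans (⟦⟧-≗ (node o A₁ A₂) w≗)
        (cong₂ (op o) (⟦⟧-merge-true A₁ (proj₁ colouring)) (⟦⟧-merge-false A₂ (proj₂ colouring)))
  where colouring = member-colouring A₁#A₂

⟦⟧-surjective : ∀ A → ReadOnce A → ∀ b → ∃ λ v → ⟦ A ⟧ v ≡ b
⟦⟧-surjective (lit c p) _ b = (λ _ → signed c b) , signed-involutive c b
⟦⟧-surjective (node o A₁ A₂) ro@(node ro₁ ro₂ _) b with b ≟ᵇ o
... | yes refl with ⟦⟧-surjective A₁ ro₁ o | ⟦⟧-surjective A₂ ro₂ o
...   | v₁ , e₁ | v₂ , e₂ =
  merge (member (vars A₁)) v₁ v₂ ,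
  trans (⟦⟧-merge-node ro v₁ v₂ (λ _ → refl)) (trans (cong₂ (op o) e₁ e₂) (op-identityˡ o o))
⟦⟧-surjective (node o A₁ A₂) (node ro₁ _ _) b | no b≢o with ⟦⟧-surjective A₁ ro₁ (not o)
... | v , e = v , trans (cong (λ x → op o x (⟦ A₂ ⟧ v)) e) (trans (op-zeroˡ o _) (sym (¬-not b≢o)))

essential : ∀ A → ReadOnce A → ∀ {p} → p ∈ vars A →
  ∃₂ λ w b → ∀ α → ⟦ A ⟧ (w [ p ≔ α ]) ≡ signed b α
essential (lit b p) _ (here refl) = (λ _ → false) , b , λ α → cong (signed b) (≔-same _ p α)
essential (node o A₁ A₂) ro@(node ro₁ ro₂ A₁#A₂) {p} p∈ with ∈-++⁻ (vars A₁) p∈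
... | inj₁ p∈₁ with essential A₁ ro₁ p∈₁ | ⟦⟧-surjective A₂ ro₂ o
...   | w , b , e | u , A₂u≡o = merge X w u , b , λ α → begin
  ⟦ node o A₁ A₂ ⟧ (merge X w u [ p ≔ α ])            ≡⟨ ⟦⟧-merge-node ro _ _ (merge-≔ X w u p α) ⟩
  op o (⟦ A₁ ⟧ (w [ p ≔ α ])) (⟦ A₂ ⟧ (u [ p ≔ α ]))  ≡⟨ cong₂ (op o) (e α) (trans (⟦⟧-≔-∉ A₂ α p∉₂) A₂u≡o) ⟩
  op o (signed b α) o                                 ≡⟨ op-identityʳ o _ ⟩
  signed b α                                          ∎
  where
  X = member (vars A₁)
  p∉₂ = λ p∈₂ → A₁#A₂ (p∈₁ , p∈₂)
essential (node o A₁ A₂) ro@(node ro₁ ro₂ A₁#A₂) {p} p∈ | inj₂ p∈₂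
  with ⟦⟧-surjective A₁ ro₁ o | essential A₂ ro₂ p∈₂
...   | u , A₁u≡o | w , b , e = merge X u w , b , λ α → begin
  ⟦ node o A₁ A₂ ⟧ (merge X u w [ p ≔ α ])            ≡⟨ ⟦⟧-merge-node ro _ _ (merge-≔ X u w p α) ⟩
  op o (⟦ A₁ ⟧ (u [ p ≔ α ])) (⟦ A₂ ⟧ (w [ p ≔ α ]))  ≡⟨ cong₂ (op o) (trans (⟦⟧-≔-∉ A₁ α p∉₁) A₁u≡o) (e α) ⟩
  op o o (signed b α)                                 ≡⟨ op-identityˡ o _ ⟩
  signed b α                                          ∎
  where
  X = member (vars A₁)
  p∉₁ = λ p∈₁ → A₁#A₂ (p∈₁ , p∈₂)

profile : NNF → Valuation → ℕ → ℕ → Bool → Bool → Bool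
profile A w p q α β = ⟦ A ⟧ (w [ p ≔ α ] [ q ≔ β ])

profile-∉ʳ : ∀ A {w p q α β} → q ∉ vars A → profile A w p q α β ≡ ⟦ A ⟧ (w [ p ≔ α ])
profile-∉ʳ A {w} {p} {α = α} {β} q∉ = ⟦⟧-≔-∉ A {w [ p ≔ α ]} β q∉

profile-∉ˡ : ∀ A {w p q α β} → p ∉ vars A → profile A w p q α β ≡ ⟦ A ⟧ (w [ q ≔ β ])
profile-∉ˡ A {w} {α = α} {β} p∉ = ⟦⟧-local A (λ r∈ → ≔-≔-other w α β λ { refl → p∉ r∈ })

profile-∉ : ∀ A {w p q α β} → p ∉ vars A → q ∉ vars A → profile A w p q α β ≡ ⟦ A ⟧ w
profile-∉ A {w} {α = α} p∉ q∉ = trans (profile-∉ʳ A q∉) (⟦⟧-≔-∉ A {w} α p∉)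

essential₂ : ∀ {o A₁ A₂ p q} → ReadOnce (node o A₁ A₂) → p ∈ vars A₁ → q ∈ vars A₂ →
  ∃₂ λ w b → ∃ λ b′ → ∀ α β → profile (node o A₁ A₂) w p q α β ≡ op o (signed b α) (signed b′ β)
essential₂ {o} {A₁} {A₂} {p} {q} ro@(node ro₁ ro₂ A₁#A₂) p∈₁ q∈₂
  with essential A₁ ro₁ p∈₁ | essential A₂ ro₂ q∈₂
... | w₁ , b , e₁ | w₂ , b′ , e₂ = merge X w₁ w₂ , b , b′ , λ α β → begin
  profile (node o A₁ A₂) (merge X w₁ w₂) p q α β        ≡⟨ ⟦⟧-merge-node ro _ _ (merged α β) ⟩
  op o (profile A₁ w₁ p q α β) (profile A₂ w₂ p q α β)  ≡⟨ cong₂ (op o) (profile-∉ʳ A₁ q∉₁) (profile-∉ˡ A₂ p∉₂) ⟩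
  op o (⟦ A₁ ⟧ (w₁ [ p ≔ α ])) (⟦ A₂ ⟧ (w₂ [ q ≔ β ]))  ≡⟨ cong₂ (op o) (e₁ α) (e₂ β) ⟩
  op o (signed b α) (signed b′ β)                       ∎
  where
  X = member (vars A₁)
  q∉₁ = λ q∈₁ → A₁#A₂ (q∈₁ , q∈₂)
  p∉₂ = λ p∈₂ → A₁#A₂ (p∈₁ , p∈₂)
  merged : ∀ α β →
    merge X w₁ w₂ [ p ≔ α ] [ q ≔ β ] ≗ merge X (w₁ [ p ≔ α ] [ q ≔ β ]) (w₂ [ p ≔ α ] [ q ≔ β ])
  merged α β r =
    trans (≔-cong q β (merge-≔ X w₁ w₂ p α) r) (merge-≔ X (w₁ [ p ≔ α ]) (w₂ [ p ≔ α ]) q β r)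

-- f⁻¹(c) is a product of two subsets of Bool.
Rectangular : Bool → (Bool → Bool → Bool) → Set
Rectangular c f = ∀ α β α′ β′ → f α β ≡ c → f α′ β′ ≡ c → f α β′ ≡ c

rectangular-≗ : ∀ {c f g} → (∀ α β → f α β ≡ g α β) → Rectangular c f → Rectangular c g
rectangular-≗ f≡g rect α β α′ β′ e₁ e₂ =
  trans (sym (f≡g α β′)) (rect α β α′ β′ (trans (f≡g α β) e₁) (trans (f≡g α′ β′) e₂))

rectangular-op : ∀ {c f g} o k → Rectangular c f → (∀ α β → g α β ≡ op o (f α β) k) → Rectangular c g
rectangular-op o k rect g≡ with op-by-constant o k
... | inj₁ unit = rectangular-≗ (λ α β → sym (trans (g≡ α β) (unit _))) rect
... | inj₂ zero = λ α β _ β′ e₁ _ →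
  trans (trans (g≡ α β′) (zero _)) (trans (sym (zero _)) (trans (sym (g≡ α β)) e₁))

op-signed-not-rectangular : ∀ o b b′ → ¬ Rectangular (not o) (λ α β → op o (signed b α) (signed b′ β))
op-signed-not-rectangular o b b′ rect = not-¬ refl (begin
  o                                                         ≡⟨ sym (op-identityˡ o o) ⟩
  op o o o                                                  ≡⟨ sym (cong₂ (op o) (inv b o) (inv b′ o)) ⟩
  op o (signed b (signed b o)) (signed b′ (signed b′ o))    ≡⟨ rect _ _ _ _ e₁ e₂ ⟩
  not o                                                     ∎)
  where
  inv = signed-involutive
  e₁ : op o (signed b (signed b o)) (signed b′ (signed b′ (not o))) ≡ not o
  e₁ = trans (cong₂ (op o) (inv b o) (inv b′ (not o))) (op-zeroʳ o o)
  e₂ : op o (signed b (signed b (not o))) (signed b′ (signed b′ o)) ≡ not o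
  e₂ = trans (cong₂ (op o) (inv b (not o)) (inv b′ o)) (op-zeroˡ o o)

data Meet (o : Bool) (p q : ℕ) : NNF → Set where
  here  : ∀ {A B} → p ∈ vars A → q ∈ vars B → Meet o p q (node o A B)
  left  : ∀ {o′ A B} → Meet o p q A → Meet o p q (node o′ A B)
  right : ∀ {o′ A B} → Meet o p q B → Meet o p q (node o′ A B)

meet-vars : ∀ {o p q A} → Meet o p q A → p ∈ vars A × q ∈ vars A
meet-vars (here {A} p∈ q∈)  = ∈-++⁺ˡ p∈ , ∈-++⁺ʳ (vars A) q∈
meet-vars (left m)          = ∈-++⁺ˡ (proj₁ (meet-vars m)) , ∈-++⁺ˡ (proj₂ (meet-vars m))
meet-vars (right {A = A} m) = ∈-++⁺ʳ (vars A) (proj₁ (meet-vars m)) , ∈-++⁺ʳ (vars A) (proj₂ (meet-vars m))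

meet-rectangular : ∀ {o p q A} → ReadOnce A → Meet o p q A → ∀ w → Rectangular o (profile A w p q)
meet-rectangular {o} {p} {q} (node _ _ A₁#A₂) (here {A₁} {A₂} p∈₁ q∈₂) w α β α′ β′ e₁ e₂ = begin
  op o (profile A₁ w p q α β′) (profile A₂ w p q α β′)  ≡⟨ cong₂ (op o) β-irrelevant α-irrelevant ⟩
  op o (profile A₁ w p q α β) (profile A₂ w p q α′ β′)  ≡⟨ cong₂ (op o) unit₁ unit₂ ⟩
  op o o o                                              ≡⟨ op-identityˡ o o ⟩
  o                                                     ∎
  where
  q∉₁ = λ q∈₁ → A₁#A₂ (q∈₁ , q∈₂)
  p∉₂ = λ p∈₂ → A₁#A₂ (p∈₁ , p∈₂)
  β-irrelevant = trans (profile-∉ʳ A₁ q∉₁) (sym (profile-∉ʳ A₁ q∉₁))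
  α-irrelevant = trans (profile-∉ˡ A₂ p∉₂) (sym (profile-∉ˡ A₂ p∉₂))
  unit₁ = proj₁ (op-identity-inv o _ _ e₁)
  unit₂ = proj₂ (op-identity-inv o _ _ e₂)
meet-rectangular (node ro₁ _ A₁#A₂) (left {o′} {A₁} {A₂} m) w =
  rectangular-op o′ (⟦ A₂ ⟧ w) (meet-rectangular ro₁ m w) λ α β →
    cong (op o′ _) (profile-∉ A₂ (λ p∈₂ → A₁#A₂ (p∈₁ , p∈₂)) (λ q∈₂ → A₁#A₂ (q∈₁ , q∈₂)))
  where p∈₁ = proj₁ (meet-vars m) ; q∈₁ = proj₂ (meet-vars m)
meet-rectangular (node _ ro₂ A₁#A₂) (right {o′} {A₁} {A₂} m) w =
  rectangular-op o′ (⟦ A₁ ⟧ w) (meet-rectangular ro₂ m w) λ α β →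
    trans (op-comm o′ _ _)
          (cong (op o′ _) (profile-∉ A₁ (λ p∈₁ → A₁#A₂ (p∈₁ , p∈₂)) (λ q∈₁ → A₁#A₂ (q∈₁ , q∈₂))))
  where p∈₂ = proj₁ (meet-vars m) ; q∈₂ = proj₂ (meet-vars m)

meet-determined : ∀ {o o′ A₁ A₂ B p q} → ReadOnce (node o A₁ A₂) → p ∈ vars A₁ → q ∈ vars A₂ →
  ReadOnce B → node o A₁ A₂ ≋ B → Meet o′ p q B → o′ ≡ o
meet-determined {o} {o′} {B = B} {p} {q} ro p∈₁ q∈₂ roB A≋B m with o′ ≟ᵇ o | essential₂ ro p∈₁ q∈₂
... | yes o′≡o | _ = o′≡o
... | no o′≢o | w , b , b′ , exposed = ⊥-elim (op-signed-not-rectangular o b b′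
  (rectangular-≗ (λ α β → trans (sym (A≋B _)) (exposed α β))
    (subst (λ c → Rectangular c (profile B w p q)) (¬-not o′≢o) (meet-rectangular roB m w))))

combine : Bool → Maybe NNF → Maybe NNF → Maybe NNF
combine o nothing  y        = y
combine o (just A) nothing  = just A
combine o (just A) (just B) = just (node o A B)

restrict : (ℕ → Bool) → NNF → Maybe NNF
restrict X (lit b p)    = if X p then just (lit b p) else nothing
restrict X (node o A B) = combine o (restrict X A) (restrict X B)

varsᵐ : Maybe NNF → List ℕ
varsᵐ = maybe vars []

vars-combine : ∀ o x y → varsᵐ (combine o x y) ≡ varsᵐ x ++ varsᵐ y
vars-combine o nothing  y        = refl
vars-combine o (just A) nothing  = sym (++-identityʳ (vars A))
vars-combine o (just A) (just B) = refl

∈-restrict⁺ : ∀ X A {r} → r ∈ vars A → X r ≡ true → r ∈ varsᵐ (restrict X A)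
∈-restrict⁺ X (lit b p) (here refl) Xp rewrite Xp = here refl
∈-restrict⁺ X (node o A B) r∈ Xr rewrite vars-combine o (restrict X A) (restrict X B) =
  [ (λ r∈A → ∈-++⁺ˡ (∈-restrict⁺ X A r∈A Xr)) , (λ r∈B → ∈-++⁺ʳ _ (∈-restrict⁺ X B r∈B Xr)) ]′ (∈-++⁻ (vars A) r∈)

∈-restrict⁻ : ∀ X A r → r ∈ varsᵐ (restrict X A) → r ∈ vars A × X r ≡ true
∈-restrict⁻ X (lit b p) r r∈ with X p in Xp
∈-restrict⁻ X (lit b p) r (here refl) | true = here refl , Xp
∈-restrict⁻ X (node o A B) r r∈ rewrite vars-combine o (restrict X A) (restrict X B)
  with ∈-++⁻ (varsᵐ (restrict X A)) r∈
... | inj₁ r∈A = map₁ ∈-++⁺ˡ (∈-restrict⁻ X A r r∈A)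
... | inj₂ r∈B = map₁ (∈-++⁺ʳ (vars A)) (∈-restrict⁻ X B r r∈B)

readOnce-combine : ∀ o {x y} → MaybeAll.All ReadOnce x → MaybeAll.All ReadOnce y →
  Disjoint (varsᵐ x) (varsᵐ y) → MaybeAll.All ReadOnce (combine o x y)
readOnce-combine o nothing    roy       _   = roy
readOnce-combine o (just rox) nothing   _   = just rox
readOnce-combine o (just rox) (just roy) x#y = just (node rox roy x#y)

readOnce-restrict : ∀ X {A} → ReadOnce A → MaybeAll.All ReadOnce (restrict X A)
readOnce-restrict X {lit b p} lit with X p
... | true  = just lit
... | false = nothing
readOnce-restrict X {node o A B} (node roA roB A#B) =
  readOnce-combine o (readOnce-restrict X roA) (readOnce-restrict X roB)
    λ (r∈A , r∈B) → A#B (proj₁ (∈-restrict⁻ X A _ r∈A) , proj₁ (∈-restrict⁻ X B _ r∈B))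

restrict-all : ∀ X A → Coloured X true (vars A) → restrict X A ≡ just A
restrict-all X (lit b p) in-X rewrite in-X (here refl) = refl
restrict-all X (node o A B) in-X
  rewrite restrict-all X A (in-X ∘ ∈-++⁺ˡ) | restrict-all X B (in-X ∘ ∈-++⁺ʳ (vars A)) = refl

restrict-none : ∀ X A → Coloured X false (vars A) → restrict X A ≡ nothing
restrict-none X (lit b p) out-X rewrite out-X (here refl) = refl
restrict-none X (node o A B) out-X
  rewrite restrict-none X A (out-X ∘ ∈-++⁺ˡ) | restrict-none X B (out-X ∘ ∈-++⁺ʳ (vars A)) = refl

infix 4 _≈ᵐ_

_≈ᵐ_ : Maybe NNF → Maybe NNF → Set
_≈ᵐ_ = Pointwise _≈_

≈-isEquivalence : IsEquivalence _≈_
≈-isEquivalence = record { refl = ax-refl ; sym = r-sym ; trans = r-trans }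

≈ᵐ-refl : ∀ {x} → x ≈ᵐ x
≈ᵐ-refl = Pointwise.refl ax-refl

combine-cong : ∀ o {x x′ y y′} → x ≈ᵐ x′ → y ≈ᵐ y′ → combine o x y ≈ᵐ combine o x′ y′
combine-cong o (just A≈) (just B≈) = just (node-cong o A≈ B≈)
combine-cong o (just A≈) nothing   = just A≈
combine-cong o nothing   y≈        = y≈

combine-assoc : ∀ o x y z → combine o (combine o x y) z ≈ᵐ combine o x (combine o y z)
combine-assoc o (just A) (just B) (just C) = just (node-assoc o A B C)
combine-assoc o nothing  _        _        = ≈ᵐ-refl
combine-assoc o (just _) nothing  _        = ≈ᵐ-refl
combine-assoc o (just _) (just _) nothing  = ≈ᵐ-refl

combine-comm : ∀ o x y → combine o x y ≈ᵐ combine o y x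
combine-comm o (just A) (just B) = just (node-comm o A B)
combine-comm o (just _) nothing  = ≈ᵐ-refl
combine-comm o nothing  (just _) = ≈ᵐ-refl
combine-comm o nothing  nothing  = nothing

combine-commutativeSemigroup : Bool → CommutativeSemigroup 0ℓ 0ℓ
combine-commutativeSemigroup o = record
  { _≈_ = _≈ᵐ_
  ; _∙_ = combine o
  ; isCommutativeSemigroup = record
    { isSemigroup = record
      { isMagma = record
        { isEquivalence = Pointwise.isEquivalence ≈-isEquivalence
        ; ∙-cong = combine-cong o
        }
      ; assoc = combine-assoc o
      }
    ; comm = combine-comm o
    }
  }

some-var : ∀ A → ∃ λ p → p ∈ vars A
some-var (lit _ p)    = p , here refl
some-var (node _ A _) = map₂ ∈-++⁺ˡ (some-var A)

uniform : ∀ X {o B₁ B₂} → (∀ {p q} → p ∈ vars B₁ → q ∈ vars B₂ → X p ≡ X q) →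
  ∃ λ c → Coloured X c (vars (node o B₁ B₂))
uniform X {B₁ = B₁} {B₂} cross with some-var B₁ | some-var B₂
... | s , s∈ | t , t∈ = X s , λ r∈ →
  [ (λ r∈₁ → trans (cross r∈₁ t∈) (sym (cross s∈ t∈))) , (λ r∈₂ → sym (cross s∈ r∈₂)) ]′ (∈-++⁻ (vars B₁) r∈)

restrict-uniform : ∀ o X {c} B → Coloured X c (vars B) → just B ≈ᵐ combine o (restrict X B) (restrict (not ∘ X) B)
restrict-uniform o X {true} B in-X
  rewrite restrict-all X B in-X | restrict-none (not ∘ X) B (cong not ∘ in-X) = ≈ᵐ-refl
restrict-uniform o X {false} B out-X
  rewrite restrict-none X B out-X | restrict-all (not ∘ X) B (cong not ∘ out-X) = ≈ᵐ-refl

SplitsAt : Bool → (ℕ → Bool) → NNF → Set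
SplitsAt o X B = ∀ {o′ p q} → Meet o′ p q B → X p ≢ X q → o′ ≡ o

split : ∀ o X {B} → ReadOnce B → SplitsAt o X B → just B ≈ᵐ combine o (restrict X B) (restrict (not ∘ X) B)
split o X {lit b p} lit _ with X p
... | true  = ≈ᵐ-refl
... | false = ≈ᵐ-refl
split o X {node o′ B₁ B₂} (node ro₁ ro₂ _) splits with o′ ≟ᵇ o
... | yes refl = Pointwise.trans r-trans
  (combine-cong o (split o X ro₁ (splits ∘ left)) (split o X ro₂ (splits ∘ right)))
  (interchange (restrict X B₁) (restrict (not ∘ X) B₁) (restrict X B₂) (restrict (not ∘ X) B₂))
  where open CommutativeSemigroupProperties (combine-commutativeSemigroup o) using (interchange)
... | no o′≢o = restrict-uniform o X (node o′ B₁ B₂) (proj₂ (uniform X {o′} {B₁} {B₂} λ p∈ q∈ →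
  decidable-stable (_ ≟ᵇ _) λ Xp≢Xq → o′≢o (splits (here p∈ q∈) Xp≢Xq)))

record Decomposition (o : Bool) (X : ℕ → Bool) (B : NNF) : Set where
  field
    part₁ part₂ : NNF
    readOnce₁   : ReadOnce part₁
    readOnce₂   : ReadOnce part₂
    coloured₁   : Coloured X true (vars part₁)
    coloured₂   : Coloured X false (vars part₂)
    ≈-parts     : B ≈ node o part₁ part₂

decompose : ∀ {o X B p q} → ReadOnce B → SplitsAt o X B →
  p ∈ vars B → X p ≡ true → q ∈ vars B → X q ≡ false → Decomposition o X B
decompose {o} {X} {B} ro splits p∈ Xp q∈ Xq
  with restrict X B | restrict (not ∘ X) B | split o X ro splits
     | ∈-restrict⁺ X B p∈ Xp | ∈-restrict⁺ (not ∘ X) B q∈ (cong not Xq)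
     | ∈-restrict⁻ X B | ∈-restrict⁻ (not ∘ X) B
     | readOnce-restrict X ro | readOnce-restrict (not ∘ X) ro
-- The remaining cases are absurd: p or q would lie in varsᵐ nothing = [].
... | just B₁ | just B₂ | just B≈ | _ | _ | in₁ | in₂ | just ro₁ | just ro₂ = record
  { part₁ = B₁ ; part₂ = B₂ ; readOnce₁ = ro₁ ; readOnce₂ = ro₂
  ; coloured₁ = λ r∈ → proj₂ (in₁ _ r∈)
  ; coloured₂ = λ r∈ → not-injective (proj₂ (in₂ _ r∈))
  ; ≈-parts = B≈
  }

-- If B₂ took the zero of op o at u, A₁ would be constant; but read-once formulae take both values.
cancelˡ : ∀ {o X A₁ A₂ B₁ B₂} → ReadOnce A₁ → ReadOnce A₂ →
  Coloured X true (vars A₁ ++ vars B₁) → Coloured X false (vars A₂ ++ vars B₂) →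
  node o A₁ A₂ ≋ node o B₁ B₂ → A₁ ≋ B₁
cancelˡ {o} {X} {A₁} {A₂} {B₁} {B₂} ro₁ ro₂ in-X out-X A≋B =
  [ (λ unit v → trans (A₁≡ v) (unit _))
  , (λ zero → ⊥-elim (not-¬ refl (trans (sym A₁v₀≡o) (trans (A₁≡ v₀) (zero _)))))
  ]′ (op-by-constant o (⟦ B₂ ⟧ u))
  where
  u = proj₁ (⟦⟧-surjective A₂ ro₂ o)
  A₂u≡o = proj₂ (⟦⟧-surjective A₂ ro₂ o)
  v₀ = proj₁ (⟦⟧-surjective A₁ ro₁ o)
  A₁v₀≡o = proj₂ (⟦⟧-surjective A₁ ro₁ o)
  A₁≡ : ∀ v → ⟦ A₁ ⟧ v ≡ op o (⟦ B₁ ⟧ v) (⟦ B₂ ⟧ u)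
  A₁≡ v = begin
    ⟦ A₁ ⟧ v                                            ≡⟨ sym (op-identityʳ o _) ⟩
    op o (⟦ A₁ ⟧ v) o                                   ≡⟨ sym (cong₂ (op o) A₁-part A₂-part) ⟩
    ⟦ node o A₁ A₂ ⟧ (merge X v u)                      ≡⟨ A≋B _ ⟩
    op o (⟦ B₁ ⟧ (merge X v u)) (⟦ B₂ ⟧ (merge X v u))  ≡⟨ cong₂ (op o) B₁-part B₂-part ⟩
    op o (⟦ B₁ ⟧ v) (⟦ B₂ ⟧ u)                          ∎
    where
    A₁-part = ⟦⟧-merge-true A₁ (in-X ∘ ∈-++⁺ˡ)
    A₂-part = trans (⟦⟧-merge-false A₂ (out-X ∘ ∈-++⁺ˡ)) A₂u≡o
    B₁-part = ⟦⟧-merge-true B₁ (in-X ∘ ∈-++⁺ʳ (vars A₁))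
    B₂-part = ⟦⟧-merge-false B₂ (out-X ∘ ∈-++⁺ʳ (vars A₂))

cancelʳ : ∀ {o X A₁ A₂ B₁ B₂} → ReadOnce A₁ → ReadOnce A₂ →
  Coloured X true (vars A₁ ++ vars B₁) → Coloured X false (vars A₂ ++ vars B₂) →
  node o A₁ A₂ ≋ node o B₁ B₂ → A₂ ≋ B₂
cancelʳ {o} {X} {A₁} {A₂} {B₁} {B₂} ro₁ ro₂ in-X out-X A≋B =
  cancelˡ {o} {not ∘ X} {A₂} {A₁} {B₂} {B₁} ro₂ ro₁ (cong not ∘ out-X) (cong not ∘ in-X)
    λ v → trans (op-comm o _ _) (trans (A≋B v) (op-comm o _ _))

vars-⊆ : ∀ {A B} → ReadOnce B → A ≋ B → vars B ⊆ vars A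
vars-⊆ {A} {B} roB A≋B {p} p∈B with p ∈? vars A
... | yes p∈A = p∈A
... | no p∉A with essential B roB p∈B
... | w , b , e = ⊥-elim (signed-distinct b (begin
  signed b true            ≡⟨ sym (e true) ⟩
  ⟦ B ⟧ (w [ p ≔ true ])   ≡⟨ sym (A≋B _) ⟩
  ⟦ A ⟧ (w [ p ≔ true ])   ≡⟨ ⟦⟧-≔-∉ A true p∉A ⟩
  ⟦ A ⟧ w                  ≡⟨ sym (⟦⟧-≔-∉ A false p∉A) ⟩
  ⟦ A ⟧ (w [ p ≔ false ])  ≡⟨ A≋B _ ⟩
  ⟦ B ⟧ (w [ p ≔ false ])  ≡⟨ e false ⟩
  signed b false           ∎))

readOnce-lit : ∀ {B p} → ReadOnce B → vars B ⊆ [ p ] → ∃ λ c → B ≡ lit c p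
readOnce-lit {lit c _} lit ⊆p with ⊆p (here refl)
... | here refl = c , refl
readOnce-lit {node _ B₁ B₂} (node _ _ B₁#B₂) ⊆p with some-var B₁ | some-var B₂
... | s , s∈ | t , t∈ with ⊆p (∈-++⁺ˡ s∈) | ⊆p (∈-++⁺ʳ (vars B₁) t∈)
... | here refl | here refl = ⊥-elim (B₁#B₂ (s∈ , t∈))

∈-++-resolve : ∀ xs {ys} {r : ℕ} → r ∈ xs ++ ys → r ∉ xs → r ∈ ys
∈-++-resolve xs r∈ r∉xs = [ (λ r∈xs → ⊥-elim (r∉xs r∈xs)) , (λ r∈ys → r∈ys) ]′ (∈-++⁻ xs r∈)

equivalent-splitsAt : ∀ {o A₁ A₂ B} → ReadOnce (node o A₁ A₂) → ReadOnce B → node o A₁ A₂ ≋ B →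
  SplitsAt o (member (vars A₁)) B
equivalent-splitsAt {o} {A₁} {A₂} ro@(node ro₁ ro₂ A₁#A₂) roB A≋B {p = p} {q} m Xp≢Xq
  with vars-⊆ {node o A₁ A₂} roB A≋B (proj₁ (meet-vars m))
     | vars-⊆ {node o A₁ A₂} roB A≋B (proj₂ (meet-vars m))
     | p ∈? vars A₁ | q ∈? vars A₁
... | _   | _   | yes _   | yes _   = ⊥-elim (Xp≢Xq refl)
... | _   | _   | no _    | no _    = ⊥-elim (Xp≢Xq refl)
... | _   | q∈A | yes p∈₁ | no q∉₁  = meet-determined ro p∈₁ (∈-++-resolve (vars A₁) q∈A q∉₁) roB A≋B m
... | p∈A | _   | no p∉₁  | yes q∈₁ =
  meet-determined (node ro₂ ro₁ λ (r∈₂ , r∈₁) → A₁#A₂ (r∈₁ , r∈₂)) (∈-++-resolve (vars A₁) p∈A p∉₁) q∈₁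
    roB (λ v → trans (op-comm o _ _) (A≋B v)) m

complete-readOnce : ∀ A → ReadOnce A → ∀ {B} → ReadOnce B → A ≋ B → A ≈ B
complete-readOnce (lit b p) lit roB A≋B with readOnce-lit {p = p} roB (vars-⊆ {lit b p} roB A≋B)
... | c , refl with trans (sym (signed-true b)) (trans (A≋B (λ _ → true)) (signed-true c))
... | refl = ax-refl
complete-readOnce (node o A₁ A₂) ro@(node ro₁ ro₂ A₁#A₂) {B} roB A≋B =
  r-trans (node-cong o (complete-readOnce A₁ ro₁ readOnce₁ A₁≋part₁) (complete-readOnce A₂ ro₂ readOnce₂ A₂≋part₂))
          (r-sym ≈-parts)
  where
  X = member (vars A₁)
  colouring = member-colouring A₁#A₂
  s∈ = proj₂ (some-var A₁)
  t∈ = proj₂ (some-var A₂)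
  A⊆B : vars (node o A₁ A₂) ⊆ vars B
  A⊆B = vars-⊆ {B} ro (λ v → sym (A≋B v))
  open Decomposition (decompose roB (equivalent-splitsAt ro roB A≋B)
    (A⊆B (∈-++⁺ˡ s∈)) (proj₁ colouring s∈) (A⊆B (∈-++⁺ʳ (vars A₁) t∈)) (proj₂ colouring t∈))
  A≋parts : node o A₁ A₂ ≋ node o part₁ part₂
  A≋parts v = trans (A≋B v) (≈⇒≋ ≈-parts v)
  in-X : Coloured X true (vars A₁ ++ vars part₁)
  in-X r∈ = [ proj₁ colouring , coloured₁ ]′ (∈-++⁻ (vars A₁) r∈)
  out-X : Coloured X false (vars A₂ ++ vars part₂)
  out-X r∈ = [ proj₂ colouring , coloured₂ ]′ (∈-++⁻ (vars A₂) r∈)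
  A₁≋part₁ : A₁ ≋ part₁
  A₁≋part₁ = cancelˡ {o} {X} {A₁} {A₂} {part₁} {part₂} ro₁ ro₂ in-X out-X A≋parts
  A₂≋part₂ : A₂ ≋ part₂
  A₂≋part₂ = cancelʳ {o} {X} {A₁} {A₂} {part₁} {part₂} ro₁ ro₂ in-X out-X A≋parts

mainTheorem4 : ∀ (A B : Formula) → Diversified A → Diversified B →
    (TautEquiv A B → A ⊢↔ B) × (A ⊢↔ B → TautEquiv A B)
mainTheorem4 A B divA divB = completeness , sound
  where
  completeness : TautEquiv A B → A ⊢↔ B
  completeness A⇔B = r-trans (nnf-⊢↔ A) (r-trans nnfA≈nnfB (r-sym (nnf-⊢↔ B)))
    where
    nnfA≈nnfB : nnf A ≈ nnf B
    nnfA≈nnfB = complete-readOnce (nnf A) (readOnce-nnf A divA) {nnf B} (readOnce-nnf B divB)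
      λ v → trans (⟦nnf⟧ v A) (trans (A⇔B v) (sym (⟦nnf⟧ v B)))
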